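{- For each integer $s\ge 1$, if $n\ge \operatorname{Ram}(4,7;s^2)$, then $\operatorname{ldim}(I_n)>s$.
   Context: For $n\ge 2$, the canonical interval order $I_n$ is the poset whose elements are the closed intervals $[i,j]$ with $i<j$ integers in $\{1,\dots,n\}$, ordered by $[i,j]<[k,l]$ iff $j<k$. $\operatorname{Ram}(k,h;r)$ denotes the least positive integer $N$ such that for every $n\ge N$ and every coloring of the $k$-element subsets of $\{1,\dots,n\}$ with $r$ colors there is an $h$-element subset all of whose $k$-element subsets receive the same color. A partial linear extension (ple) of a poset $P$ is a linear extension of a subposet of $P$. For a family $\mathcal{L}$ of ple's, $\mu(u,\mathcal{L})$ is the number of members containing $u$ and $\mu(\mathcal{L})=\max_u \mu(u,\mathcal{L})$. A non-empty family $\mathcal{L}$ of ple's is a local realizer of $P$ if (1) whenever $x\le y$ in $P$ some $L\in\mathcal{L}$ has $x\le y$ in $L$, and (2) whenever $x\parallel y$ in $P$ some $L\in\mathcal{L}$ has $x>y$ in $L$. $\operatorname{ldim}(P)$ is the minimum of $\mu(\mathcal{L})$ over local realizers $\mathcal{L}$ of $P$. -}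

module Defs where

open import Data.Nat using (ℕ; zero; suc; _≤_; _<_; _⊔_; _≟_)
open import Data.Nat.Properties using (≤-irrelevant)
open import Data.Fin using (Fin) renaming (_≤_ to _≤F_; _<_ to _<F_)
open import Data.Fin.Subset using (Subset; _⊆_; ∣_∣)
open import Data.List using (List; []; length; lookup; filter; map; foldr; concat)
open import Data.List.Membership.Propositional using (_∈_)
open import Data.List.Membership.DecPropositional using () renaming (_∈?_ to member?)
open import Data.List.Relation.Unary.Any using (Any)
open import Data.List.Relation.Unary.All using (All)
open import Data.List.Relation.Unary.Unique.Propositional using (Unique)
open import Data.Product using (Σ; ∃; _×_; _,_; ∃-syntax)
open import Data.Sum using (_⊎_)
open import Relation.Nullary using (¬_; yes; no)
open import Relation.Binary.Definitions using (DecidableEquality)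
open import Relation.Binary.PropositionalEquality using (_≡_; _≢_; refl; cong)

-- Ramsey numbers.
-- k-element subsets of {1,…,n} are modelled as k-element subsets of
-- Fin n (= {0,…,n-1}, relabelled by i ↦ i+1).

KSub : ℕ → ℕ → Set
KSub n k = Σ (Subset n) (λ S → ∣ S ∣ ≡ k)

Arrows : ℕ → ℕ → ℕ → ℕ → Set
Arrows n k h r =
  (χ : KSub n k → Fin r) →
  ∃[ H ] (∣ H ∣ ≡ h × ∃[ c ] ((S : KSub n k) → Σ.proj₁ S ⊆ H → χ S ≡ c))
  where open Data.Product

RamseyProp : ℕ → ℕ → ℕ → ℕ → Set
RamseyProp k h r N = (n : ℕ) → N ≤ n → Arrows n k h r

IsRam : ℕ → ℕ → ℕ → ℕ → Set
IsRam k h r N =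
  1 ≤ N × RamseyProp k h r N × ((M : ℕ) → 1 ≤ M → RamseyProp k h r M → N ≤ M)

module _ {A : Set} (_≤P_ : A → A → Set) where

  _∥P_ : A → A → Set
  x ∥P y = ¬ (x ≤P y) × ¬ (y ≤P x)

  -- A ple is represented as the list of its elements in increasing
  -- order: no repetitions, and it is a linear extension of the induced
  -- subposet on its elements, i.e. no later element is ≤P an earlier one.
  IsPle : List A → Set
  IsPle L = Unique L ×
    ((i j : Fin (length L)) → i <F j → ¬ (lookup L j ≤P lookup L i))

  _≤[_]_ : A → List A → A → Set
  x ≤[ L ] y = ∃[ i ] ∃[ j ] (i ≤F j × lookup L i ≡ x × lookup L j ≡ y)

  _<[_]_ : A → List A → A → Set
  x <[ L ] y = ∃[ i ] ∃[ j ] (i <F j × lookup L i ≡ x × lookup L j ≡ y)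

  IsLocalRealizer : List (List A) → Set
  IsLocalRealizer 𝓛 =
    𝓛 ≢ [] × All IsPle 𝓛 ×
    (∀ x y → x ≤P y → Any (λ L → x ≤[ L ] y) 𝓛) ×
    (∀ x y → x ∥P y → Any (λ L → y <[ L ] x) 𝓛)

module _ {A : Set} (_≟A_ : DecidableEquality A) where

  μ-at : A → List (List A) → ℕ
  μ-at u 𝓛 = length (filter (λ L → member? _≟A_ u L) 𝓛)

  -- μ(𝓛) = max_u μ(u,𝓛)  (elements in no member contribute 0, so it
  -- suffices to range over elements occurring in some member)
  μ : List (List A) → ℕ
  μ 𝓛 = foldr _⊔_ 0 (map (λ u → μ-at u 𝓛) (concat 𝓛))

record Interval (n : ℕ) : Set where
  constructor [_,_]⟨_,_,_⟩
  field
    lo hi : ℕ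
    1≤lo  : 1 ≤ lo
    lo<hi : lo < hi
    hi≤n  : hi ≤ n
open Interval public

_≤I_ : {n : ℕ} → Interval n → Interval n → Set
x ≤I y = x ≡ y ⊎ hi x < lo y

_≟I_ : {n : ℕ} → DecidableEquality (Interval n)
[ a , b ]⟨ p , q , r ⟩ ≟I [ c , d ]⟨ p' , q' , r' ⟩ with a ≟ c | b ≟ d
... | no a≢c | _ = no (λ e → a≢c (cong lo e))
... | yes _ | no b≢d = no (λ e → b≢d (cong hi e))
... | yes refl | yes refl
  rewrite ≤-irrelevant p p' | ≤-irrelevant q q' | ≤-irrelevant r r' = yes refl

ldim-I-exceeds : ℕ → ℕ → Set
ldim-I-exceeds n s = (𝓛 : List (List (Interval n))) →
  IsLocalRealizer (_≤I_ {n}) 𝓛 → s Data.Nat.< μ (_≟I_ {n}) 𝓛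

-- Let 𝓛 be a local realizer of I_n with μ(𝓛) ≤ s. For points a < b < c < d the
-- intervals [a,c] and [b,d] are incomparable, so some L ∈ 𝓛 puts [b,d] below
-- [a,c]. Colour {a,b,c,d} by the pair (position of L among the members of 𝓛
-- containing [a,c], position of L among those containing [b,d]); both positions
-- are < s, so this is an s²-colouring of the 4-subsets. On a monochromatic
-- 7-set p₁ < ⋯ < p₇ the quadruples (p₂,p₅,p₆,p₇), (p₂,p₃,p₆,p₇), (p₁,p₃,p₄,p₇)
-- and (p₁,p₂,p₄,p₆) consecutively share an interval and a colour, hence the same L.
-- That L then has [p₅,p₇] < [p₂,p₆] < [p₁,p₄], although [p₁,p₄] < [p₅,p₇] in I_n.

module Submission where

open import Defs
open import Data.Nat as ℕ using (ℕ; zero; suc; _≤_; _*_; _⊔_; s<s; s<s⁻¹)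
open import Data.Nat.Properties as ℕ using (≤-trans; <-≤-trans; m≤m⊔n; m≤n⊔m; ≮⇒≥)
open import Data.Fin as Fin using (Fin; zero; suc; toℕ; fromℕ<; combine; remQuot; _<_)
open import Data.Fin.Properties as Fin using (_<?_; toℕ<n; fromℕ<-injective; remQuot-combine)
open import Data.Fin.Subset using (Subset; inside; outside; ∣_∣; ⋃; ⁅_⁆; _⊆_) renaming (_∈_ to _∈ₛ_)
open import Data.Fin.Subset.Properties using (x∈⁅x⁆; x∈⁅y⁆⇒x≡y; x∈p∪q⁺; x∈p∪q⁻; ∉⊥)
open import Data.Vec using ([]; _∷_; here; there)
open import Data.List using (List; []; _∷_; length; lookup; filter; map; foldr; concat)
open import Data.List.Properties using (length-map)
open import Data.List.Membership.Propositional using (_∈_)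
open import Data.List.Membership.Propositional.Properties using (∈-lookup; ∈-map⁺; ∈-map⁻; ∈-concat⁺′)
open import Data.List.Membership.DecPropositional using () renaming (_∈?_ to member?)
open import Data.List.Relation.Unary.Any using (Any; here; there; index)
open import Data.List.Relation.Unary.Any.Properties using (lookup-index)
open import Data.List.Relation.Unary.All as All using (All; []; _∷_)
open import Data.List.Relation.Unary.AllPairs as AllPairs using (AllPairs; []; _∷_)
import Data.List.Relation.Unary.AllPairs.Properties as AllPairs
import Data.List.Relation.Unary.All.Properties as All
open import Data.List.Relation.Unary.Unique.Propositional using (Unique)
open import Data.Product using (_×_; _,_; proj₁; proj₂; uncurry; ∃-syntax)
open import Data.Sum using (inj₁; inj₂; [_,_]′)
open import Data.Bool using (true; false)
open import Data.Empty using (⊥; ⊥-elim)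
open import Function using (_∘_)
open import Level using (0ℓ)
open import Relation.Nullary using (¬_; yes; no; does)
open import Relation.Nullary.Decidable using (recompute)
open import Relation.Unary using (Pred; Decidable)
open import Relation.Binary using (Rel; Asymmetric; DecidableEquality)
open import Relation.Binary.PropositionalEquality using (_≡_; refl; sym; trans; cong; cong₂; subst)

private
  variable
    A : Set
    n s : ℕ

lookup-injective : (xs : List A) → Unique xs → ∀ i j → lookup xs i ≡ lookup xs j → i ≡ j
lookup-injective (x ∷ xs) u        zero    zero    _ = refl
lookup-injective (x ∷ xs) (x∉ ∷ u) zero    (suc j) e = ⊥-elim (All.lookup x∉ (∈-lookup j) e)
lookup-injective (x ∷ xs) (x∉ ∷ u) (suc i) zero    e = ⊥-elim (All.lookup x∉ (∈-lookup i) (sym e))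
lookup-injective (x ∷ xs) (x∉ ∷ u) (suc i) (suc j) e = cong suc (lookup-injective xs u i j e)

module _ {R : Rel A 0ℓ} (R-asym : Asymmetric R) where

  AllPairs-⊆⊇⇒≡ : ∀ {xs ys} → AllPairs R xs → AllPairs R ys →
                  (∀ {z} → z ∈ xs → z ∈ ys) → (∀ {z} → z ∈ ys → z ∈ xs) → xs ≡ ys
  AllPairs-⊆⊇⇒≡ {[]}     {[]}     _ _ _ _ = refl
  AllPairs-⊆⊇⇒≡ {[]}     {y ∷ ys} _ _ _ ⊇ with ⊇ (here refl)
  ... | ()
  AllPairs-⊆⊇⇒≡ {x ∷ xs} {[]}     _ _ ⊆ _ with ⊆ (here refl)
  ... | ()
  AllPairs-⊆⊇⇒≡ {x ∷ xs} {y ∷ ys} (Rx ∷ sorted-xs) (Ry ∷ sorted-ys) ⊆ ⊇ =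
    cong₂ _∷_ x≡y (AllPairs-⊆⊇⇒≡ sorted-xs sorted-ys ⊆-tail ⊇-tail)
    where
    R-irrefl : ∀ {z} → ¬ R z z
    R-irrefl r = R-asym r r

    x≡y : x ≡ y
    x≡y with ⊆ (here refl) | ⊇ (here refl)
    ... | here x≡y  | _          = x≡y
    ... | _         | here y≡x   = sym y≡x
    ... | there x∈ys | there y∈xs = ⊥-elim (R-asym (All.lookup Rx y∈xs) (All.lookup Ry x∈ys))

    ⊆-tail : ∀ {z} → z ∈ xs → z ∈ ys
    ⊆-tail z∈xs with ⊆ (there z∈xs)
    ... | here z≡y   = ⊥-elim (R-irrefl (subst (R x) (trans z≡y (sym x≡y)) (All.lookup Rx z∈xs)))
    ... | there z∈ys = z∈ys

    ⊇-tail : ∀ {z} → z ∈ ys → z ∈ xs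
    ⊇-tail z∈ys with ⊇ (there z∈ys)
    ... | here z≡x   = ⊥-elim (R-irrefl (subst (R y) (trans z≡x x≡y) (All.lookup Ry z∈ys)))
    ... | there z∈xs = z∈xs

∈⇒≤-foldr-⊔ : ∀ {m ms} → m ∈ ms → m ≤ foldr _⊔_ 0 ms
∈⇒≤-foldr-⊔ {ms = m ∷ ms}  (here refl) = m≤m⊔n m _
∈⇒≤-foldr-⊔ {ms = m′ ∷ ms} (there m∈)  = ≤-trans (∈⇒≤-foldr-⊔ m∈) (m≤n⊔m m′ _)

-- When entry k satisfies P, rank xs k is its position inside filter P? xs.
module _ {P : Pred A 0ℓ} (P? : Decidable P) where

  rank : (xs : List A) → Fin (length xs) → ℕ
  rank (x ∷ xs) zero    = 0
  rank (x ∷ xs) (suc k) with does (P? x)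
  ... | true  = suc (rank xs k)
  ... | false = rank xs k

  rank-< : (xs : List A) (k : Fin (length xs)) → P (lookup xs k) →
           rank xs k ℕ.< length (filter P? xs)
  rank-< (x ∷ xs) zero px with P? x
  ... | yes _  = s<s ℕ.z≤n
  ... | no ¬px = ⊥-elim (¬px px)
  rank-< (x ∷ xs) (suc k) pk with P? x
  ... | yes _ = s<s (rank-< xs k pk)
  ... | no _  = rank-< xs k pk

  rank-injective : (xs : List A) (k k′ : Fin (length xs)) →
                   P (lookup xs k) → P (lookup xs k′) → rank xs k ≡ rank xs k′ → k ≡ k′
  rank-injective (x ∷ xs) zero zero _ _ _ = refl
  rank-injective (x ∷ xs) zero (suc k′) px _ e with P? x
  ... | no ¬px = ⊥-elim (¬px px)
  rank-injective (x ∷ xs) (suc k) zero _ px e with P? x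
  ... | no ¬px = ⊥-elim (¬px px)
  rank-injective (x ∷ xs) (suc k) (suc k′) pk pk′ e with P? x
  ... | yes _ = cong suc (rank-injective xs k k′ pk pk′ (ℕ.suc-injective e))
  ... | no _  = cong suc (rank-injective xs k k′ pk pk′ e)

μ-at≤μ : (_≟_ : DecidableEquality A) {u : A} {𝓛 : List (List A)} →
         u ∈ concat 𝓛 → μ-at _≟_ u 𝓛 ≤ μ _≟_ 𝓛
μ-at≤μ _≟_ {𝓛 = 𝓛} u∈ = ∈⇒≤-foldr-⊔ (∈-map⁺ (λ v → μ-at _≟_ v 𝓛) u∈)

combine-injective : ∀ {m} (i i′ : Fin m) (j j′ : Fin n) →
                    combine i j ≡ combine i′ j′ → (i , j) ≡ (i′ , j′)
combine-injective {n = n} i i′ j j′ e =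
  trans (sym (remQuot-combine i j)) (trans (cong (remQuot n) e) (remQuot-combine i′ j′))

module _ (_≤P_ : Rel A 0ℓ) {L : List A} (ple : IsPle _≤P_ L) where

  <[]-trans : ∀ {x y z} → _<[_]_ _≤P_ x L y → _<[_]_ _≤P_ y L z → _<[_]_ _≤P_ x L z
  <[]-trans (i , j , i<j , x≡ , y≡) (j′ , k , j′<k , y≡′ , z≡) =
    i , k , Fin.<-trans i<j (subst (_< k) (sym j≡j′) j′<k) , x≡ , z≡
    where
    j≡j′ : j ≡ j′
    j≡j′ = lookup-injective L (proj₁ ple) j j′ (trans y≡ (sym y≡′))

  <[]⇒≱ : ∀ {x y} → _<[_]_ _≤P_ x L y → ¬ (y ≤P x)
  <[]⇒≱ (i , j , i<j , refl , refl) = proj₂ ple i j i<j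

<[]⇒∈ˡ : ∀ (_≤P_ : Rel A 0ℓ) {x y L} → _<[_]_ _≤P_ x L y → x ∈ L
<[]⇒∈ˡ _ (i , _ , _ , refl , _) = ∈-lookup i

<[]⇒∈ʳ : ∀ (_≤P_ : Rel A 0ℓ) {x y L} → _<[_]_ _≤P_ x L y → y ∈ L
<[]⇒∈ʳ _ (_ , j , _ , _ , refl) = ∈-lookup j

-- Subsets of Fin n as strictly increasing lists

elements : Subset n → List (Fin n)
elements []            = []
elements (inside ∷ S)  = zero ∷ map suc (elements S)
elements (outside ∷ S) = map suc (elements S)

fromList : List (Fin n) → Subset n
fromList xs = ⋃ (map ⁅_⁆ xs)

length-elements : (S : Subset n) → length (elements S) ≡ ∣ S ∣
length-elements []            = refl
length-elements (inside ∷ S)  = cong suc (trans (length-map suc (elements S)) (length-elements S))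
length-elements (outside ∷ S) = trans (length-map suc (elements S)) (length-elements S)

elements-sorted : (S : Subset n) → AllPairs _<_ (elements S)
elements-sorted []            = []
elements-sorted (inside ∷ S)  =
  All.map⁺ (All.universal (λ _ → s<s ℕ.z≤n) (elements S)) ∷
  AllPairs.map⁺ (AllPairs.map s<s (elements-sorted S))
elements-sorted (outside ∷ S) = AllPairs.map⁺ (AllPairs.map s<s (elements-sorted S))

∈-elements⁻ : (S : Subset n) {x : Fin n} → x ∈ elements S → x ∈ₛ S
∈-elements⁻ (inside ∷ S) (here refl) = here
∈-elements⁻ (inside ∷ S) (there x∈) with ∈-map⁻ suc x∈
... | _ , y∈ , refl = there (∈-elements⁻ S y∈)
∈-elements⁻ (outside ∷ S) x∈ with ∈-map⁻ suc x∈
... | _ , y∈ , refl = there (∈-elements⁻ S y∈)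

∈-elements⁺ : (S : Subset n) {x : Fin n} → x ∈ₛ S → x ∈ elements S
∈-elements⁺ (inside ∷ S)  here         = here refl
∈-elements⁺ (inside ∷ S)  (there x∈S)  = there (∈-map⁺ suc (∈-elements⁺ S x∈S))
∈-elements⁺ (outside ∷ S) (there x∈S)  = ∈-map⁺ suc (∈-elements⁺ S x∈S)

∈-fromList⁻ : (xs : List (Fin n)) {x : Fin n} → x ∈ₛ fromList xs → x ∈ xs
∈-fromList⁻ []       x∈ = ⊥-elim (∉⊥ x∈)
∈-fromList⁻ (y ∷ xs) x∈ =
  [ here ∘ x∈⁅y⁆⇒x≡y y , there ∘ ∈-fromList⁻ xs ]′ (x∈p∪q⁻ ⁅ y ⁆ (fromList xs) x∈)

∈-fromList⁺ : {xs : List (Fin n)} {x : Fin n} → x ∈ xs → x ∈ₛ fromList xs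
∈-fromList⁺ (here refl) = x∈p∪q⁺ (inj₁ (x∈⁅x⁆ _))
∈-fromList⁺ (there x∈)  = x∈p∪q⁺ (inj₂ (∈-fromList⁺ x∈))

elements-fromList : {xs : List (Fin n)} → AllPairs _<_ xs → elements (fromList xs) ≡ xs
elements-fromList {xs = xs} sorted =
  AllPairs-⊆⊇⇒≡ Fin.<-asym (elements-sorted (fromList xs)) sorted
    (∈-fromList⁻ xs ∘ ∈-elements⁻ (fromList xs)) (∈-elements⁺ (fromList xs) ∘ ∈-fromList⁺)

<-recompute : {i j : Fin n} → .(i < j) → i < j
<-recompute {i = i} {j} = recompute (i <? j)

-- Fin n = {0,…,n-1} is shifted to {1,…,n}. The order proof is irrelevant, so
-- the interval depends on its endpoints only, definitionally.
interval : (i j : Fin n) → .(i < j) → Interval n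
interval i j i<j = [ suc (toℕ i) , suc (toℕ j) ]⟨ s<s ℕ.z≤n , s<s (<-recompute i<j) , toℕ<n j ⟩

crossing-∥ : {a b c d : Fin n} (a<b : a < b) (b<c : b < c) (c<d : c < d) →
             _∥P_ _≤I_ (interval a c (Fin.<-trans a<b b<c)) (interval b d (Fin.<-trans b<c c<d))
crossing-∥ a<b b<c c<d =
  [ (λ e → ℕ.<-irrefl (ℕ.suc-injective (cong lo e)) a<b) , (λ c<b → ℕ.<-asym b<c (s<s⁻¹ c<b)) ]′ ,
  [ (λ e → ℕ.<-irrefl (ℕ.suc-injective (cong lo (sym e))) a<b) , (λ d<a → ℕ.<-asym a<d (s<s⁻¹ d<a)) ]′
  where
  a<d = Fin.<-trans a<b (Fin.<-trans b<c c<d)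

record Quadruple (n : ℕ) : Set where
  constructor quadruple
  field
    a b c d : Fin n
    .a<b    : a < b
    .b<c    : b < c
    .c<d    : c < d
open Quadruple

points : Quadruple n → List (Fin n)
points q = a q ∷ b q ∷ c q ∷ d q ∷ []

points-sorted : (q : Quadruple n) → AllPairs _<_ (points q)
points-sorted (quadruple _ _ _ _ a<b b<c c<d) =
  (ab ∷ Fin.<-trans ab bc ∷ Fin.<-trans ab (Fin.<-trans bc cd) ∷ []) ∷
  (bc ∷ Fin.<-trans bc cd ∷ []) ∷ (cd ∷ []) ∷ [] ∷ []
  where
  ab = <-recompute a<b
  bc = <-recompute b<c
  cd = <-recompute c<d

toQuadruple : (xs : List (Fin n)) → AllPairs _<_ xs → length xs ≡ 4 → Quadruple n
toQuadruple (a ∷ b ∷ c ∷ d ∷ []) sorted _ =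
  quadruple a b c d (first sorted) (first (AllPairs.tail sorted))
                    (first (AllPairs.tail (AllPairs.tail sorted)))
  where
  first : ∀ {x y xs} → AllPairs _<_ (x ∷ y ∷ xs) → x < y
  first = All.head ∘ AllPairs.head

toQuadruple-points : ∀ {xs} (q : Quadruple n) (sorted : AllPairs _<_ xs) (len : length xs ≡ 4) →
                     xs ≡ points q → toQuadruple xs sorted len ≡ q
toQuadruple-points q sorted len refl = refl

left right : Quadruple n → Interval n
left  (quadruple a _ c _ a<b b<c _) = interval a c (Fin.<-trans a<b b<c)
right (quadruple _ b _ d _ b<c c<d) = interval b d (Fin.<-trans b<c c<d)

left∥right : (q : Quadruple n) → _∥P_ _≤I_ (left q) (right q)
left∥right (quadruple _ _ _ _ a<b b<c c<d) =
  crossing-∥ (<-recompute a<b) (<-recompute b<c) (<-recompute c<d)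

-- The colouring induced by a local realizer

module _ {𝓛 : List (List (Interval n))} (realizer : IsLocalRealizer _≤I_ 𝓛)
         (μ≤s : μ _≟I_ 𝓛 ≤ s) where

  private
    ples : All (IsPle _≤I_) 𝓛
    ples = proj₁ (proj₂ realizer)

  rankAmong : Interval n → Fin (length 𝓛) → ℕ
  rankAmong u = rank (member? _≟I_ u) 𝓛

  rankAmong-< : ∀ {u k} → u ∈ lookup 𝓛 k → rankAmong u k ℕ.< s
  rankAmong-< {u} {k} u∈ =
    <-≤-trans (rank-< (member? _≟I_ u) 𝓛 k u∈)
              (≤-trans (μ-at≤μ _≟I_ {𝓛 = 𝓛} (∈-concat⁺′ u∈ (∈-lookup {xs = 𝓛} k))) μ≤s)

  rankFin : ∀ {u k} → u ∈ lookup 𝓛 k → Fin s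
  rankFin u∈ = fromℕ< (rankAmong-< u∈)

  rankFin-injective : ∀ {u k k′} (u∈ : u ∈ lookup 𝓛 k) (u∈′ : u ∈ lookup 𝓛 k′) →
                      rankFin u∈ ≡ rankFin u∈′ → k ≡ k′
  rankFin-injective {u} {k} {k′} u∈ u∈′ e =
    rank-injective (member? _≟I_ u) 𝓛 k k′ u∈ u∈′
      (fromℕ<-injective _ _ (rankAmong-< u∈) (rankAmong-< u∈′) e)

  reversed : (q : Quadruple n) → Any (λ L → _<[_]_ _≤I_ (right q) L (left q)) 𝓛
  reversed q = proj₂ (proj₂ (proj₂ realizer)) (left q) (right q) (left∥right q)

  witness : Quadruple n → Fin (length 𝓛)
  witness q = index (reversed q)

  right<left : (q : Quadruple n) → _<[_]_ _≤I_ (right q) (lookup 𝓛 (witness q)) (left q)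
  right<left q = lookup-index (reversed q)

  left∈ : (q : Quadruple n) → left q ∈ lookup 𝓛 (witness q)
  left∈ q = <[]⇒∈ʳ _≤I_ (right<left q)

  right∈ : (q : Quadruple n) → right q ∈ lookup 𝓛 (witness q)
  right∈ q = <[]⇒∈ˡ _≤I_ (right<left q)

  colour : Quadruple n → Fin s × Fin s
  colour q = rankFin (left∈ q) , rankFin (right∈ q)

  χ : KSub n 4 → Fin (s * s)
  χ (S , ∣S∣≡4) = uncurry combine (colour (toQuadruple (elements S) (elements-sorted S)
                                                        (trans (length-elements S) ∣S∣≡4)))

  subsetOf : Quadruple n → KSub n 4
  subsetOf q = fromList (points q) ,
    trans (sym (length-elements (fromList (points q))))
          (cong length (elements-fromList (points-sorted q)))

  χ-subsetOf : (q : Quadruple n) → χ (subsetOf q) ≡ uncurry combine (colour q)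
  χ-subsetOf q = cong (uncurry combine ∘ colour)
    (toQuadruple-points q _ _ (elements-fromList (points-sorted q)))

  module _ (H : Subset n) (c : Fin (s * s)) (mono : (S : KSub n 4) → proj₁ S ⊆ H → χ S ≡ c) where

    colour-inside : (q q′ : Quadruple n) → All (_∈ₛ H) (points q) → All (_∈ₛ H) (points q′) →
                    colour q ≡ colour q′
    colour-inside q q′ q⊆H q′⊆H =
      combine-injective _ _ _ _ (trans (inside-c q q⊆H) (sym (inside-c q′ q′⊆H)))
      where
      inside-c : (q : Quadruple n) → All (_∈ₛ H) (points q) → uncurry combine (colour q) ≡ c
      inside-c q q⊆H = trans (sym (χ-subsetOf q))
        (mono (subsetOf q) (All.lookup q⊆H ∘ ∈-fromList⁻ (points q)))

    no-sorted-7 : (xs : List (Fin n)) → AllPairs _<_ xs → length xs ≡ 7 → All (_∈ₛ H) xs → ⊥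
    no-sorted-7 (p₁ ∷ p₂ ∷ p₃ ∷ p₄ ∷ p₅ ∷ p₆ ∷ p₇ ∷ [])
      ((p₁<p₂ ∷ _) ∷ (p₂<p₃ ∷ _) ∷ (p₃<p₄ ∷ _) ∷ (p₄<p₅ ∷ _) ∷ (p₅<p₆ ∷ _) ∷ (p₆<p₇ ∷ _) ∷ _) _
      (m₁ ∷ m₂ ∷ m₃ ∷ m₄ ∷ m₅ ∷ m₆ ∷ m₇ ∷ []) =
      <[]⇒≱ _≤I_ ple right₁<left₄ (inj₂ (s<s p₄<p₅))
      where
      _⟫_ : ∀ {i j k : Fin n} → i < j → j < k → i < k
      _⟫_ = Fin.<-trans

      q₁ q₂ q₃ q₄ : Quadruple n
      q₁ = quadruple p₂ p₅ p₆ p₇ (p₂<p₃ ⟫ (p₃<p₄ ⟫ p₄<p₅)) p₅<p₆ p₆<p₇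
      q₂ = quadruple p₂ p₃ p₆ p₇ p₂<p₃ (p₃<p₄ ⟫ (p₄<p₅ ⟫ p₅<p₆)) p₆<p₇
      q₃ = quadruple p₁ p₃ p₄ p₇ (p₁<p₂ ⟫ p₂<p₃) p₃<p₄ (p₄<p₅ ⟫ (p₅<p₆ ⟫ p₆<p₇))
      q₄ = quadruple p₁ p₂ p₄ p₆ p₁<p₂ (p₂<p₃ ⟫ p₃<p₄) (p₄<p₅ ⟫ p₅<p₆)

      -- q₁ and q₂ share [p₂,p₆], q₂ and q₃ share [p₃,p₇], q₃ and q₄ share [p₁,p₄].
      witness₁≡witness₂ : witness q₁ ≡ witness q₂
      witness₁≡witness₂ = rankFin-injective (left∈ q₁) (left∈ q₂)
        (cong proj₁ (colour-inside q₁ q₂ (m₂ ∷ m₅ ∷ m₆ ∷ m₇ ∷ []) (m₂ ∷ m₃ ∷ m₆ ∷ m₇ ∷ [])))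

      witness₂≡witness₃ : witness q₂ ≡ witness q₃
      witness₂≡witness₃ = rankFin-injective (right∈ q₂) (right∈ q₃)
        (cong proj₂ (colour-inside q₂ q₃ (m₂ ∷ m₃ ∷ m₆ ∷ m₇ ∷ []) (m₁ ∷ m₃ ∷ m₄ ∷ m₇ ∷ [])))

      witness₃≡witness₄ : witness q₃ ≡ witness q₄
      witness₃≡witness₄ = rankFin-injective (left∈ q₃) (left∈ q₄)
        (cong proj₁ (colour-inside q₃ q₄ (m₁ ∷ m₃ ∷ m₄ ∷ m₇ ∷ []) (m₁ ∷ m₂ ∷ m₄ ∷ m₆ ∷ [])))

      L : List (Interval n)
      L = lookup 𝓛 (witness q₁)

      ple : IsPle _≤I_ L
      ple = All.lookup ples (∈-lookup {xs = 𝓛} (witness q₁))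

      right₄<left₄ : _<[_]_ _≤I_ (right q₄) L (left q₄)
      right₄<left₄ = subst (λ k → _<[_]_ _≤I_ (right q₄) (lookup 𝓛 k) (left q₄))
        (sym (trans witness₁≡witness₂ (trans witness₂≡witness₃ witness₃≡witness₄))) (right<left q₄)

      right₁<left₄ : _<[_]_ _≤I_ (right q₁) L (left q₄)
      right₁<left₄ = <[]-trans _≤I_ ple (right<left q₁) right₄<left₄

  realizer⇒¬Arrows : ¬ Arrows n 4 7 (s * s)
  realizer⇒¬Arrows arrows = no-monochromatic-7 (arrows χ)
    where
    no-monochromatic-7 : ¬ (∃[ H ] (∣ H ∣ ≡ 7 × ∃[ c ] ((S : KSub n 4) → proj₁ S ⊆ H → χ S ≡ c)))
    no-monochromatic-7 (H , ∣H∣≡7 , c , mono) =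
      no-sorted-7 H c mono (elements H) (elements-sorted H) (trans (length-elements H) ∣H∣≡7)
        (All.tabulate (∈-elements⁻ H))

theorem2p1 : (s : ℕ) → 1 ≤ s → (N : ℕ) → IsRam 4 7 (s * s) N →
    (n : ℕ) → N ≤ n → ldim-I-exceeds n s
theorem2p1 s _ N (_ , ramsey , _) n N≤n 𝓛 realizer with s ℕ.<? μ _≟I_ 𝓛
... | yes s<μ = s<μ
... | no  s≮μ = ⊥-elim (realizer⇒¬Arrows realizer (≮⇒≥ s≮μ) (ramsey n N≤n))
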